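{- If a sequent $\Gamma\Rightarrow\Delta$ is derivable in $\mathbf{G}(\mathsf{FBInqBQ})$, then $\Gamma\Rightarrow\Delta$ has a derivation in $\mathbf{G}(\mathsf{FBInqBQ})$ such that every labelled formula occurring in the derivation is a subexpression of some labelled formula in $\Gamma,\Delta$.
   Context: Language: countably infinite set $\mathsf{Var}$ of variables, countably infinite set of predicate symbols with arities (no identity, constants, function symbols). Formulas: $\varphi ::= P(x_1,\dots,x_m)\mid \bot\mid \varphi\to\varphi\mid\varphi\wedge\varphi\mid \varphi\veebar\varphi\mid \forall x\varphi\mid \bar\exists x\varphi$ ($\veebar$ inquisitive disjunction, $\bar\exists$ inquisitive existential). $\varphi[z/x]$ is capture-avoiding substitution. Subformulas: $\mathtt{Sub}$ is defined as usual for atoms, $\bot$ and binary connectives (each formula is a subformula of itself, and subformulas of immediate components are subformulas), with $\mathtt{Sub}(\forall x\psi)=\{\forall x\psi\}\cup\bigcup_{z\in\mathsf{Var}}\mathtt{Sub}(\psi[z/x])$ and likewise for $\bar\exists x\psi$. A labelled formula $Y:\psi$ is a subexpression of $X:\varphi$ if $\psi$ is a subformula of $\varphi$ and $Y\subseteq X$. Calculus $\mathbf{G}(\mathsf{FBInqBQ})$: a label is a nonempty finite subset of $\omega$; a labelled formula is $X:\varphi$ with $X$ a label; a sequent $\Gamma\Rightarrow\Delta$ is a pair of finite multisets of labelled formulas. $X,Y$ range over labels. Initial sequents: $(\mathtt{id})$ $X:P(\bar x),\Gamma\Rightarrow\Delta,Y:P(\bar x)$ whenever $X\supseteq Y$;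 $(\bot\Rightarrow)$ $X:\bot,\Gamma\Rightarrow\Delta$. Rules (premises / conclusion): $(\Rightarrow\mathtt{at})$: $\Gamma\Rightarrow\Delta,\{k\}:P(\bar x)$ for every $k\in X$ / $\Gamma\Rightarrow\Delta,X:P(\bar x)$. $(\Rightarrow\wedge)$: $\Gamma\Rightarrow\Delta,X:\varphi$ and $\Gamma\Rightarrow\Delta,X:\psi$ / $\Gamma\Rightarrow\Delta,X:\varphi\wedge\psi$. $(\wedge\Rightarrow)$: $X:\varphi,X:\psi,\Gamma\Rightarrow\Delta$ / $X:\varphi\wedge\psi,\Gamma\Rightarrow\Delta$. $(\Rightarrow\veebar)$: $\Gamma\Rightarrow\Delta,X:\varphi,X:\psi$ / $\Gamma\Rightarrow\Delta,X:\varphi\veebar\psi$. $(\veebar\Rightarrow)$: $X:\varphi,\Gamma\Rightarrow\Delta$ and $X:\psi,\Gamma\Rightarrow\Delta$ / $X:\varphi\veebar\psi,\Gamma\Rightarrow\Delta$. $(\Rightarrow\to)$: $Y:\varphi,\Gamma\Rightarrow\Delta,Y:\psi$ for every label $Y\subseteq X$ / $\Gamma\Rightarrow\Delta,X:\varphi\to\psi$. $(\to\Rightarrow)$, for a label $Y\subseteq X$: $X:\varphi\to\psi,\Gamma\Rightarrow\Delta,Y:\varphi$ and $Y:\psi,X:\varphi\to\psi,\Gamma\Rightarrow\Delta$ / $X:\varphi\to\psi,\Gamma\Rightarrow\Delta$. $(\Rightarrow\forall)$: $\Gamma\Rightarrow\Delta,X:\varphi[z/x]$ / $\Gamma\Rightarrow\Delta,X:\forall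 x\varphi$, with $z$ not occurring in the conclusion. $(\forall\Rightarrow)$: $X:\varphi[y/x],X:\forall x\varphi,\Gamma\Rightarrow\Delta$ / $X:\forall x\varphi,\Gamma\Rightarrow\Delta$ ($y$ arbitrary). $(\Rightarrow\bar\exists)$: $\Gamma\Rightarrow\Delta,X:\bar\exists x\varphi,X:\varphi[y/x]$ / $\Gamma\Rightarrow\Delta,X:\bar\exists x\varphi$ ($y$ arbitrary). $(\bar\exists\Rightarrow)$: $X:\varphi[z/x],\Gamma\Rightarrow\Delta$ / $X:\bar\exists x\varphi,\Gamma\Rightarrow\Delta$, with $z$ not occurring in the conclusion. A derivation is a finite tree of sequents built from initial sequents by these rules; a sequent is derivable if it is the root of a derivation. -}

module Defs where

open import Data.Nat using (ℕ; zero; suc; _<ᵇ_; _⊔_; _≟_)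
open import Data.Bool using (Bool; true; false; _∧_; if_then_else_; T)
open import Data.List using (List; []; _∷_; _++_; map; foldr; filter; concatMap)
open import Data.List.Membership.Propositional using (_∈_; _∉_)
open import Data.List.Membership.DecPropositional _≟_ using (_∈?_)
open import Data.List.Relation.Binary.Permutation.Propositional using (_↭_)
open import Data.List.Relation.Unary.All using (All)
open import Data.Vec as V using (Vec)
open import Data.Product using (Σ; _×_; _,_; proj₁; proj₂)
open import Data.Unit using (⊤; tt)
open import Relation.Nullary using (¬_; yes; no; does)
open import Relation.Nullary.Decidable using (⌊_⌋)

Var : Set
Var = ℕ

-- A predicate symbol is a pair (name p, arity m); the atom P(x₁,…,xₘ)
-- is  atom m p (x₁ ∷ … ∷ xₘ ∷ []).
infixr 6 _⇒_
infixr 7 _⩒_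
infixr 8 _∧'_

data Formula : Set where
  atom : (m : ℕ) (p : ℕ) → Vec Var m → Formula
  ⊥'   : Formula
  _⇒_  : Formula → Formula → Formula
  _∧'_ : Formula → Formula → Formula
  _⩒_  : Formula → Formula → Formula      -- inquisitive disjunction
  ∀'   : Var → Formula → Formula
  ∃'   : Var → Formula → Formula          -- inquisitive existential

fv : Formula → List Var
fv (atom m p xs) = V.toList xs
fv ⊥' = []
fv (φ ⇒ ψ) = fv φ ++ fv ψ
fv (φ ∧' ψ) = fv φ ++ fv ψ
fv (φ ⩒ ψ) = fv φ ++ fv ψ
fv (∀' x φ) = filter (λ y → ¬? (y ≟ x)) (fv φ)
  where open import Relation.Nullary.Decidable using (¬?)
fv (∃' x φ) = filter (λ y → ¬? (y ≟ x)) (fv φ)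
  where open import Relation.Nullary.Decidable using (¬?)

vars : Formula → List Var
vars (atom m p xs) = V.toList xs
vars ⊥' = []
vars (φ ⇒ ψ) = vars φ ++ vars ψ
vars (φ ∧' ψ) = vars φ ++ vars ψ
vars (φ ⩒ ψ) = vars φ ++ vars ψ
vars (∀' x φ) = x ∷ vars φ
vars (∃' x φ) = x ∷ vars φ

maxList : List ℕ → ℕ
maxList = foldr _⊔_ 0

_[_↦_] : (Var → Var) → Var → Var → (Var → Var)
(σ [ x ↦ z ]) y = if ⌊ y ≟ x ⌋ then z else σ y

-- Capture-avoiding simultaneous renaming.  A bound variable y is kept
-- unless it would capture (y ∈ σ(FV(Qy φ))); in that case it is renamed
-- to a fresh variable 1 + max σ(FV(Qy φ)).
binder : (Var → Var) → Var → Formula → Var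
binder σ y φ =
  let im = map σ (filter (λ v → Relation.Nullary.Decidable.¬? (v ≟ y)) (fv φ))
  in if ⌊ y ∈? im ⌋ then suc (maxList im) else y

rename : (Var → Var) → Formula → Formula
rename σ (atom m p xs) = atom m p (V.map σ xs)
rename σ ⊥' = ⊥'
rename σ (φ ⇒ ψ) = rename σ φ ⇒ rename σ ψ
rename σ (φ ∧' ψ) = rename σ φ ∧' rename σ ψ
rename σ (φ ⩒ ψ) = rename σ φ ⩒ rename σ ψ
rename σ (∀' y φ) = let w = binder σ y φ in ∀' w (rename (σ [ y ↦ w ]) φ)
rename σ (∃' y φ) = let w = binder σ y φ in ∃' w (rename (σ [ y ↦ w ]) φ)

_[_/_] : Formula → Var → Var → Formula
φ [ z / x ] = rename ((λ v → v) [ x ↦ z ]) φ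

-- Subformula relation: ψ ∈ Sub(φ), as the least relation closed under
-- the clauses of the paper (Sub(∀xψ) = {∀xψ} ∪ ⋃_z Sub(ψ[z/x]), etc.).
data _≼_ : Formula → Formula → Set where
  ≼-refl : ∀ {φ} → φ ≼ φ
  ≼-⇒ˡ : ∀ {χ φ ψ} → χ ≼ φ → χ ≼ (φ ⇒ ψ)
  ≼-⇒ʳ : ∀ {χ φ ψ} → χ ≼ ψ → χ ≼ (φ ⇒ ψ)
  ≼-∧ˡ : ∀ {χ φ ψ} → χ ≼ φ → χ ≼ (φ ∧' ψ)
  ≼-∧ʳ : ∀ {χ φ ψ} → χ ≼ ψ → χ ≼ (φ ∧' ψ)
  ≼-⩒ˡ : ∀ {χ φ ψ} → χ ≼ φ → χ ≼ (φ ⩒ ψ)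
  ≼-⩒ʳ : ∀ {χ φ ψ} → χ ≼ ψ → χ ≼ (φ ⩒ ψ)
  ≼-∀  : ∀ {χ x φ} (z : Var) → χ ≼ (φ [ z / x ]) → χ ≼ ∀' x φ
  ≼-∃  : ∀ {χ x φ} (z : Var) → χ ≼ (φ [ z / x ]) → χ ≼ ∃' x φ

-- Labels: nonempty finite subsets of ω, represented canonically as
-- strictly increasing nonempty lists.

increasing : ℕ → List ℕ → Bool
increasing x [] = true
increasing x (y ∷ ys) = (x <ᵇ y) ∧ increasing y ys

isLabel : List ℕ → Bool
isLabel [] = false
isLabel (x ∷ xs) = increasing x xs

Label : Set
Label = Σ (List ℕ) (λ xs → T (isLabel xs))

_∈L_ : ℕ → Label → Set
k ∈L X = k ∈ proj₁ X

_⊆L_ : Label → Label → Set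
Y ⊆L X = ∀ {k} → k ∈L Y → k ∈L X

⟦_⟧ : ℕ → Label
⟦ k ⟧ = (k ∷ [] , tt)

LFormula : Set
LFormula = Label × Formula

SubExpr : LFormula → LFormula → Set
SubExpr (Y , ψ) (X , φ) = (ψ ≼ φ) × (Y ⊆L X)

varsL : List LFormula → List Var
varsL = concatMap (λ A → vars (proj₂ A))

-- The calculus G(FBInqBQ).  Sequents are pairs of lists read as
-- multisets: a principal formula is located in the conclusion up to
-- permutation (_↭_) or by membership.

infix 4 _⊢_

data _⊢_ : List LFormula → List LFormula → Set where
  id   : ∀ {Γ Δ X Y m p} {xs : Vec Var m} →
         (X , atom m p xs) ∈ Γ → (Y , atom m p xs) ∈ Δ → Y ⊆L X → Γ ⊢ Δ
  ⊥⇒   : ∀ {Γ Δ X} → (X , ⊥') ∈ Γ → Γ ⊢ Δ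
  ⇒at  : ∀ {Γ Δ Δ' X m p} {xs : Vec Var m} →
         Δ ↭ ((X , atom m p xs) ∷ Δ') →
         (∀ k → k ∈L X → Γ ⊢ (⟦ k ⟧ , atom m p xs) ∷ Δ') → Γ ⊢ Δ
  ⇒∧   : ∀ {Γ Δ Δ' X φ ψ} → Δ ↭ ((X , φ ∧' ψ) ∷ Δ') →
         Γ ⊢ (X , φ) ∷ Δ' → Γ ⊢ (X , ψ) ∷ Δ' → Γ ⊢ Δ
  ∧⇒   : ∀ {Γ Γ' Δ X φ ψ} → Γ ↭ ((X , φ ∧' ψ) ∷ Γ') →
         (X , φ) ∷ (X , ψ) ∷ Γ' ⊢ Δ → Γ ⊢ Δ
  ⇒⩒   : ∀ {Γ Δ Δ' X φ ψ} → Δ ↭ ((X , φ ⩒ ψ) ∷ Δ') →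
         Γ ⊢ (X , φ) ∷ (X , ψ) ∷ Δ' → Γ ⊢ Δ
  ⩒⇒   : ∀ {Γ Γ' Δ X φ ψ} → Γ ↭ ((X , φ ⩒ ψ) ∷ Γ') →
         (X , φ) ∷ Γ' ⊢ Δ → (X , ψ) ∷ Γ' ⊢ Δ → Γ ⊢ Δ
  ⇒⇒   : ∀ {Γ Δ Δ' X φ ψ} → Δ ↭ ((X , φ ⇒ ψ) ∷ Δ') →
         (∀ (Y : Label) → Y ⊆L X → (Y , φ) ∷ Γ ⊢ (Y , ψ) ∷ Δ') → Γ ⊢ Δ
  ⇒⇒L  : ∀ {Γ Δ X φ ψ} → (X , φ ⇒ ψ) ∈ Γ → (Y : Label) → Y ⊆L X →
         Γ ⊢ (Y , φ) ∷ Δ → (Y , ψ) ∷ Γ ⊢ Δ → Γ ⊢ Δ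
  ⇒∀   : ∀ {Γ Δ Δ' X x φ} → Δ ↭ ((X , ∀' x φ) ∷ Δ') →
         (z : Var) → z ∉ varsL (Γ ++ Δ) →
         Γ ⊢ (X , φ [ z / x ]) ∷ Δ' → Γ ⊢ Δ
  ∀⇒   : ∀ {Γ Δ X x φ} → (X , ∀' x φ) ∈ Γ → (y : Var) →
         (X , φ [ y / x ]) ∷ Γ ⊢ Δ → Γ ⊢ Δ
  ⇒∃   : ∀ {Γ Δ X x φ} → (X , ∃' x φ) ∈ Δ → (y : Var) →
         Γ ⊢ (X , φ [ y / x ]) ∷ Δ → Γ ⊢ Δ
  ∃⇒   : ∀ {Γ Γ' Δ X x φ} → Γ ↭ ((X , ∃' x φ) ∷ Γ') →
         (z : Var) → z ∉ varsL (Γ ++ Δ) →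
         (X , φ [ z / x ]) ∷ Γ' ⊢ Δ → Γ ⊢ Δ

Every : (List LFormula → List LFormula → Set) → ∀ {Γ Δ} → Γ ⊢ Δ → Set
Every P {Γ} {Δ} (id _ _ _) = P Γ Δ
Every P {Γ} {Δ} (⊥⇒ _) = P Γ Δ
Every P {Γ} {Δ} (⇒at {X = X} _ ds) = P Γ Δ × (∀ k (h : k ∈L X) → Every P (ds k h))
Every P {Γ} {Δ} (⇒∧ _ d e) = P Γ Δ × Every P d × Every P e
Every P {Γ} {Δ} (∧⇒ _ d) = P Γ Δ × Every P d
Every P {Γ} {Δ} (⇒⩒ _ d) = P Γ Δ × Every P d
Every P {Γ} {Δ} (⩒⇒ _ d e) = P Γ Δ × Every P d × Every P e
Every P {Γ} {Δ} (⇒⇒ {X = X} _ ds) = P Γ Δ × (∀ Y (h : Y ⊆L X) → Every P (ds Y h))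
Every P {Γ} {Δ} (⇒⇒L _ _ _ d e) = P Γ Δ × Every P d × Every P e
Every P {Γ} {Δ} (⇒∀ _ _ _ d) = P Γ Δ × Every P d
Every P {Γ} {Δ} (∀⇒ _ _ d) = P Γ Δ × Every P d
Every P {Γ} {Δ} (⇒∃ _ _ d) = P Γ Δ × Every P d
Every P {Γ} {Δ} (∃⇒ _ _ _ d) = P Γ Δ × Every P d

module Submission where

-- Every rule of the calculus is analytic: each labelled formula in a premise is
-- either a side formula copied from the conclusion or an immediate subformula
-- (an instance φ[z/x] for the quantifiers) of the principal formula, carrying
-- the same or a smaller label.  Since being a subexpression is transitive, the
-- given derivation already has the subexpression property; no transformation
-- of the derivation is needed.

open import Defs
open import Data.List using (List; _∷_; _++_)
open import Data.List.Relation.Binary.Permutation.Propositional using (_↭_)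
open import Data.List.Relation.Binary.Permutation.Propositional.Properties using (All-resp-↭)
open import Data.List.Relation.Unary.All as All using (All; _∷_; lookup; tabulate; uncons)
open import Data.List.Relation.Unary.All.Properties using (++⁺; ++⁻)
open import Data.List.Relation.Unary.Any as Any using (Any; here)
open import Data.Product using (Σ; _×_; _,_)
open import Function using (_∘_)
open import Relation.Binary.PropositionalEquality using (refl)

≼-trans : ∀ {χ ψ φ} → χ ≼ ψ → ψ ≼ φ → χ ≼ φ
≼-trans p ≼-refl    = p
≼-trans p (≼-⇒ˡ q)  = ≼-⇒ˡ (≼-trans p q)
≼-trans p (≼-⇒ʳ q)  = ≼-⇒ʳ (≼-trans p q)
≼-trans p (≼-∧ˡ q)  = ≼-∧ˡ (≼-trans p q)
≼-trans p (≼-∧ʳ q)  = ≼-∧ʳ (≼-trans p q)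
≼-trans p (≼-⩒ˡ q)  = ≼-⩒ˡ (≼-trans p q)
≼-trans p (≼-⩒ʳ q)  = ≼-⩒ʳ (≼-trans p q)
≼-trans p (≼-∀ z q) = ≼-∀ z (≼-trans p q)
≼-trans p (≼-∃ z q) = ≼-∃ z (≼-trans p q)

SubExpr-refl : ∀ {A} → SubExpr A A
SubExpr-refl = ≼-refl , λ k∈X → k∈X

SubExpr-trans : ∀ {A B C} → SubExpr A B → SubExpr B C → SubExpr A C
SubExpr-trans (χ≼ψ , Z⊆Y) (ψ≼φ , Y⊆X) = ≼-trans χ≼ψ ψ≼φ , Y⊆X ∘ Z⊆Y

Within : List LFormula → List LFormula → List LFormula → Set
Within R Γ Δ = All (λ A → Any (SubExpr A) R) (Γ ++ Δ)

-- A record rather than Any (SubExpr A) R, so that A can be inferred: SubExpr A B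
-- only mentions the components of A and B, never a label's proof of canonicity.
record _within_ (A : LFormula) (R : List LFormula) : Set where
  constructor ⟨_⟩
  field subExprOfSome : Any (SubExpr A) R

open _within_

all-within-self : (R : List LFormula) → All (_within R) R
all-within-self R = tabulate (⟨_⟩ ∘ Any.map λ { {A} refl → SubExpr-refl {A} })

within-downward : ∀ {R A B} → SubExpr A B → B within R → A within R
within-downward {A = A} {B} A⊑B ⟨ b ⟩ = ⟨ Any.map (λ {C} → SubExpr-trans {A} {B} {C} A⊑B) b ⟩

within-component : ∀ {R X ψ φ} → ψ ≼ φ → (X , φ) within R → (X , ψ) within R
within-component ψ≼φ a = within-downward (ψ≼φ , λ k∈X → k∈X) a

All-uncons-↭ : ∀ {a p} {A : Set a} {P : A → Set p} {L L' x} →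
               L ↭ x ∷ L' → All P L → P x × All P L'
All-uncons-↭ L↭ = uncons ∘ All-resp-↭ L↭

module _ {R : List LFormula} where

  Within-++⁺ : ∀ {Γ Δ} → All (_within R) Γ → All (_within R) Δ → Within R Γ Δ
  Within-++⁺ hΓ hΔ = All.map subExprOfSome (++⁺ hΓ hΔ)

  Every-Within : ∀ {Γ Δ} (d : Γ ⊢ Δ) →
                 All (_within R) Γ → All (_within R) Δ → Every (Within R) d
  Every-Within (id _ _ _) hΓ hΔ = Within-++⁺ hΓ hΔ
  Every-Within (⊥⇒ _) hΓ hΔ = Within-++⁺ hΓ hΔ
  Every-Within (⇒at Δ↭ ds) hΓ hΔ =
    let a , hΔ' = All-uncons-↭ Δ↭ hΔ
    in Within-++⁺ hΓ hΔ , λ k k∈X → Every-Within (ds k k∈X) hΓ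
         (within-downward (≼-refl , λ { (here refl) → k∈X }) a ∷ hΔ')
  Every-Within (⇒∧ Δ↭ d e) hΓ hΔ =
    let a , hΔ' = All-uncons-↭ Δ↭ hΔ
    in Within-++⁺ hΓ hΔ
       , Every-Within d hΓ (within-component (≼-∧ˡ ≼-refl) a ∷ hΔ')
       , Every-Within e hΓ (within-component (≼-∧ʳ ≼-refl) a ∷ hΔ')
  Every-Within (∧⇒ Γ↭ d) hΓ hΔ =
    let a , hΓ' = All-uncons-↭ Γ↭ hΓ
    in Within-++⁺ hΓ hΔ
       , Every-Within d (within-component (≼-∧ˡ ≼-refl) a
                         ∷ within-component (≼-∧ʳ ≼-refl) a ∷ hΓ') hΔ
  Every-Within (⇒⩒ Δ↭ d) hΓ hΔ =
    let a , hΔ' = All-uncons-↭ Δ↭ hΔ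
    in Within-++⁺ hΓ hΔ
       , Every-Within d hΓ (within-component (≼-⩒ˡ ≼-refl) a
                            ∷ within-component (≼-⩒ʳ ≼-refl) a ∷ hΔ')
  Every-Within (⩒⇒ Γ↭ d e) hΓ hΔ =
    let a , hΓ' = All-uncons-↭ Γ↭ hΓ
    in Within-++⁺ hΓ hΔ
       , Every-Within d (within-component (≼-⩒ˡ ≼-refl) a ∷ hΓ') hΔ
       , Every-Within e (within-component (≼-⩒ʳ ≼-refl) a ∷ hΓ') hΔ
  Every-Within (⇒⇒ Δ↭ ds) hΓ hΔ =
    let a , hΔ' = All-uncons-↭ Δ↭ hΔ
    in Within-++⁺ hΓ hΔ , λ Y Y⊆X → Every-Within (ds Y Y⊆X)
         (within-downward (≼-⇒ˡ ≼-refl , Y⊆X) a ∷ hΓ)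
         (within-downward (≼-⇒ʳ ≼-refl , Y⊆X) a ∷ hΔ')
  Every-Within (⇒⇒L A∈Γ Y Y⊆X d e) hΓ hΔ =
    let a = lookup hΓ A∈Γ
    in Within-++⁺ hΓ hΔ
       , Every-Within d hΓ (within-downward (≼-⇒ˡ ≼-refl , Y⊆X) a ∷ hΔ)
       , Every-Within e (within-downward (≼-⇒ʳ ≼-refl , Y⊆X) a ∷ hΓ) hΔ
  Every-Within (⇒∀ Δ↭ z _ d) hΓ hΔ =
    let a , hΔ' = All-uncons-↭ Δ↭ hΔ
    in Within-++⁺ hΓ hΔ
       , Every-Within d hΓ (within-component (≼-∀ z ≼-refl) a ∷ hΔ')
  Every-Within (∀⇒ A∈Γ y d) hΓ hΔ =
    Within-++⁺ hΓ hΔ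
    , Every-Within d (within-component (≼-∀ y ≼-refl) (lookup hΓ A∈Γ) ∷ hΓ) hΔ
  Every-Within (⇒∃ A∈Δ y d) hΓ hΔ =
    Within-++⁺ hΓ hΔ
    , Every-Within d hΓ (within-component (≼-∃ y ≼-refl) (lookup hΔ A∈Δ) ∷ hΔ)
  Every-Within (∃⇒ Γ↭ z _ d) hΓ hΔ =
    let a , hΓ' = All-uncons-↭ Γ↭ hΓ
    in Within-++⁺ hΓ hΔ
       , Every-Within d (within-component (≼-∃ z ≼-refl) a ∷ hΓ') hΔ

proposition2 : (Γ Δ : List LFormula) → Γ ⊢ Δ →
    Σ (Γ ⊢ Δ) (λ d → Every (λ Γ' Δ' → All (λ A → Any (λ B → SubExpr A B) (Γ ++ Δ)) (Γ' ++ Δ')) d)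
proposition2 Γ Δ d =
  let hΓ , hΔ = ++⁻ Γ (all-within-self (Γ ++ Δ))
  in d , Every-Within d hΓ hΔ
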